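{- Let $\gamma\ge 1$ and let $G$ be a bipartite graph without isolated vertices having exactly one minimum dominating set, where $\gamma = \gamma(G)$ is the domination number of $G$, and suppose $G$ has exactly $n = 3\gamma$ vertices. Then the number of edges of $G$ satisfies $$s(G) \leq 2\gamma + 2\Big\lceil\frac{\gamma}{2}\Big\rceil\Big\lfloor\frac{\gamma}{2}\Big\rfloor.$$
   Context: All graphs are finite and simple. A dominating set of a graph $G=(V,E)$ is a set $D\subseteq V$ such that every vertex of $V\setminus D$ is adjacent to some vertex of $D$; the domination number $\gamma(G)$ is the minimum size of a dominating set, and a minimum dominating set is a dominating set of size $\gamma(G)$. $s(G)$ denotes the number of edges of $G$. -}

module Defs where

open import Data.Nat using (ℕ; zero; suc; _+_; _*_; _≤_; _<_; _/_; _<ᵇ_)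
open import Data.Bool using (Bool; true; false; if_then_else_)
open import Data.Fin using (Fin; toℕ)
open import Data.Fin.Subset using (Subset; _∈_; _∉_; ∣_∣)
open import Data.List using (List; map; allFin)
open import Data.Nat.ListAction using (sum)
open import Data.Product using (Σ; ∃; ∃-syntax; _×_; _,_)
open import Relation.Binary.PropositionalEquality using (_≡_; _≢_)
open import Relation.Nullary using (¬_)

record Graph (n : ℕ) : Set where
  field
    adj   : Fin n → Fin n → Bool
    sym   : ∀ i j → adj i j ≡ adj j i
    irref : ∀ i → adj i i ≡ false
open Graph public

Adj : ∀ {n} → Graph n → Fin n → Fin n → Set
Adj G i j = adj G i j ≡ true

countTrue : List Bool → ℕ
countTrue bs = sum (map (λ b → if b then 1 else 0) bs)

edgeCount : ∀ {n} → Graph n → ℕ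
edgeCount {n} G =
  sum (map (λ i → countTrue (map (λ j → if toℕ i <ᵇ toℕ j then adj G i j else false)
                                 (allFin n)))
           (allFin n))

Dominating : ∀ {n} → Graph n → Subset n → Set
Dominating {n} G D = ∀ (v : Fin n) → v ∉ D → ∃[ u ] (u ∈ D × Adj G u v)

MinDominating : ∀ {n} → Graph n → Subset n → Set
MinDominating {n} G D = Dominating G D × (∀ (D' : Subset n) → Dominating G D' → ∣ D ∣ ≤ ∣ D' ∣)

DominationNumber : ∀ {n} → Graph n → ℕ → Set
DominationNumber G k = ∃[ D ] (MinDominating G D × ∣ D ∣ ≡ k)

UniqueMinDominating : ∀ {n} → Graph n → Set
UniqueMinDominating {n} G =
  ∃[ D ] (MinDominating G D × (∀ (D' : Subset n) → MinDominating G D' → D' ≡ D))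

Bipartite : ∀ {n} → Graph n → Set
Bipartite {n} G = Σ (Fin n → Bool) (λ c → ∀ (u v : Fin n) → Adj G u v → c u ≢ c v)

NoIsolated : ∀ {n} → Graph n → Set
NoIsolated {n} G = ∀ (v : Fin n) → ∃[ u ] Adj G u v

⌊_/2⌋ : ℕ → ℕ
⌊ k /2⌋ = k / 2

⌈_/2⌉ : ℕ → ℕ
⌈ k /2⌉ = suc k / 2

-- Let D be the unique minimum dominating set. If some u ∈ D had fewer than two private neighbours,
-- exchanging u for a neighbour would give a second minimum dominating set; so every u ∈ D has two
-- private neighbours A u, B u outside D. As n = 3γ, the blocks {u, A u, B u} then partition the
-- vertices, and every neighbour of u outside D is A u or B u. A block contains at most two edges
-- (A u and B u have the same colour), blocks whose centres have the same colour are not joined,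
-- and two blocks whose centres have different colours are joined by at most two edges, since more
-- would allow exchanging one or two centres for vertices of the other block. Hence
-- s(G) ≤ 2γ + 2km, where k + m = γ count the vertices of D of either colour, and km ≤ ⌈γ/2⌉⌊γ/2⌋.

module Submission where

open import Defs hiding (sym)
open import Data.Nat using (ℕ; zero; suc; _+_; _*_; _∸_; _≤_; _<_; _<?_; z≤n; s≤s; _<ᵇ_; _/_)
open import Data.Nat.DivMod using (m/n≡1+[m∸n]/n; m*n/n≡m; /-monoˡ-≤)
open import Data.Nat.Properties hiding (suc-injective)
open import Data.Bool using (Bool; true; false; if_then_else_; not; _xor_)
open import Data.Fin using (Fin; zero; suc; toℕ)
open import Data.Fin.Properties using (any?; all?; suc-injective; toℕ-injective) renaming (_≟_ to _≟ᶠ_)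
open import Data.Bool.Properties using (¬-not) renaming (_≟_ to _≟ᵇ_)
open import Relation.Nullary.Reflects using (ofʸ; ofⁿ)
open import Data.Fin.Subset using (Subset; _∈_; _∉_; _⊆_; ∣_∣; _∪_; _─_; _-_; ⁅_⁆; inside; outside)
open import Data.Fin.Subset.Properties
  using (_∈?_; ∣p∣≤∣x∷p∣; ∣⁅x⁆∣≡1; x∈p⇒∣p-x∣<∣p∣; x∈p∧x≢y⇒x∈p-y; x∈⁅x⁆; x∈⁅y⁆⇒x≡y; x∈p∪q⁺; x∈p∪q⁻)
open import Data.Vec using ([]; _∷_; there)
import Data.List as List using (map; tabulate; allFin)
import Data.List.Properties as List using (map-tabulate)
import Data.Nat.ListAction as List using (sum)
open import Data.Product using (Σ-syntax; ∃-syntax; _×_; _,_; proj₁; proj₂)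
open import Data.Sum using (_⊎_; inj₁; inj₂; [_,_]′)
import Data.Sum as ⊎
open import Function using (_∘_; id)
open import Relation.Nullary using (¬_; ¬?; Dec; yes; no; does; contradiction; _×-dec_; _→-dec_)
open import Relation.Nullary.Decidable using (decidable-stable; map′)
open import Data.Empty using (⊥; ⊥-elim)
open import Relation.Binary.PropositionalEquality
open import Algebra.Properties.CommutativeMonoid.Sum +-0-commutativeMonoid
  using (sum; sum-syntax; sum-cong-≗; ∑-distrib-+; ∑-comm; sum-replicate-zero)
open import Algebra.Properties.Semiring.Sum +-*-semiring using (*-distribˡ-sum; *-distribʳ-sum)
open import Data.Nat.Solver using (module +-*-Solver)
open +-*-Solver using (solve; _:+_; _:*_; _:=_; con)

𝟙 : Bool → ℕ
𝟙 b = if b then 1 else 0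

𝟙≤1 : ∀ b → 𝟙 b ≤ 1
𝟙≤1 true  = ≤-refl
𝟙≤1 false = z≤n

𝟙-xor : ∀ x y → 𝟙 (x xor y) ≡ 𝟙 x * 𝟙 (not y) + 𝟙 (not x) * 𝟙 y
𝟙-xor true  true  = refl
𝟙-xor true  false = refl
𝟙-xor false true  = refl
𝟙-xor false false = refl

𝟙+𝟙∘not≡1 : ∀ b → 𝟙 b + 𝟙 (not b) ≡ 1
𝟙+𝟙∘not≡1 true  = refl
𝟙+𝟙∘not≡1 false = refl

𝟙+𝟙≤1 : ∀ a b → ¬ (a ≡ true × b ≡ true) → 𝟙 a + 𝟙 b ≤ 1
𝟙+𝟙≤1 true  true  ¬both = contradiction (refl , refl) ¬both
𝟙+𝟙≤1 true  false _     = ≤-refl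
𝟙+𝟙≤1 false b     _     = 𝟙≤1 b

-- For blocks {u, a, b} and {v, c, d}, e₀ … e₄ stand for the edges u v, a c, a d, b c, b d; the sum
-- has the shape of the edge count between the two blocks once u ≁ c, d and a, b ≁ v.
at-most-two-of-five : ∀ e₀ e₁ e₂ e₃ e₄ →
  ¬ (e₁ ≡ true × e₄ ≡ true) → ¬ (e₂ ≡ true × e₃ ≡ true) →
  (e₀ ≡ true → ¬ (e₁ ≡ true × e₂ ≡ true)) → (e₀ ≡ true → ¬ (e₃ ≡ true × e₄ ≡ true)) →
  (e₀ ≡ true → ¬ (e₁ ≡ true × e₃ ≡ true)) → (e₀ ≡ true → ¬ (e₂ ≡ true × e₄ ≡ true)) →
  𝟙 e₀ + 0 + 0 + (0 + 𝟙 e₁ + 𝟙 e₂) + (0 + 𝟙 e₃ + 𝟙 e₄) ≤ 2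
at-most-two-of-five false e₁ e₂ e₃ e₄ ¬e₁e₄ ¬e₂e₃ _ _ _ _ =
  subst (_≤ 2) (solve 4 (λ a b c d → (a :+ d) :+ (b :+ c) := a :+ b :+ (c :+ d)) refl (𝟙 e₁) (𝟙 e₂) (𝟙 e₃) (𝟙 e₄))
        (+-mono-≤ (𝟙+𝟙≤1 e₁ e₄ ¬e₁e₄) (𝟙+𝟙≤1 e₂ e₃ ¬e₂e₃))
at-most-two-of-five true  true  true  _     _     _     _     ¬e₁e₂ _     _     _     = contradiction (refl , refl) (¬e₁e₂ refl)
at-most-two-of-five true  true  false true  _     _     _     _     _     ¬e₁e₃ _     = contradiction (refl , refl) (¬e₁e₃ refl)
at-most-two-of-five true  true  false false true  ¬e₁e₄ _     _     _     _     _     = contradiction (refl , refl) ¬e₁e₄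
at-most-two-of-five true  true  false false false _     _     _     _     _     _     = ≤-refl
at-most-two-of-five true  false true  true  _     _     ¬e₂e₃ _     _     _     _     = contradiction (refl , refl) ¬e₂e₃
at-most-two-of-five true  false true  false true  _     _     _     _     _     ¬e₂e₄ = contradiction (refl , refl) (¬e₂e₄ refl)
at-most-two-of-five true  false true  false false _     _     _     _     _     _     = ≤-refl
at-most-two-of-five true  false false true  true  _     _     _     ¬e₃e₄ _     _     = contradiction (refl , refl) (¬e₃e₄ refl)
at-most-two-of-five true  false false true  false _     _     _     _     _     _     = ≤-refl
at-most-two-of-five true  false false false e₄    _     _     _     _     _     _     = s≤s (𝟙≤1 e₄)

-- Finite sums over Fin n

∑-mono-≤ : ∀ {n} {f g : Fin n → ℕ} → (∀ i → f i ≤ g i) → sum f ≤ sum g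
∑-mono-≤ {zero}  _   = z≤n
∑-mono-≤ {suc n} f≤g = +-mono-≤ (f≤g zero) (∑-mono-≤ (f≤g ∘ suc))

∑-zero : ∀ {n} {f : Fin n → ℕ} → (∀ i → f i ≡ 0) → sum f ≡ 0
∑-zero {n} f≡0 = trans (sum-cong-≗ f≡0) (sum-replicate-zero n)

∑-single : ∀ {n} {f : Fin n → ℕ} p → (∀ i → i ≢ p → f i ≡ 0) → sum f ≡ f p
∑-single {suc n} {f} zero    vanish =
  trans (cong (f zero +_) (∑-zero (λ i → vanish (suc i) λ ()))) (+-identityʳ (f zero))
∑-single {suc n}         (suc p) vanish =
  cong₂ _+_ (vanish zero λ ()) (∑-single p (λ i i≢p → vanish (suc i) (i≢p ∘ suc-injective)))

∑-positive⇒∃ : ∀ {n} (f : Fin n → ℕ) → 0 < sum f → ∃[ i ] 0 < f i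
∑-positive⇒∃ {suc n} f 0<∑ with f zero in f₀≡
... | suc _ = zero , subst (0 <_) (sym f₀≡) (s≤s z≤n)
... | zero  = let i , 0<fi = ∑-positive⇒∃ (f ∘ suc) 0<∑ in suc i , 0<fi

∑-≤1 : ∀ {n} (f : Fin n → ℕ) → (∀ i → f i ≤ 1) → (∀ i j → 0 < f i → 0 < f j → i ≡ j) → sum f ≤ 1
∑-≤1 f f≤1 unique with any? (λ i → 0 <? f i)
... | yes (p , 0<fp) = ≤-trans (≤-reflexive (∑-single p vanish)) (f≤1 p)
  where
  vanish : ∀ i → i ≢ p → f i ≡ 0
  vanish i i≢p = n≤0⇒n≡0 (≮⇒≥ (λ 0<fi → i≢p (unique i p 0<fi 0<fp)))
... | no none = ≤-trans (≤-reflexive (∑-zero (λ i → n≤0⇒n≡0 (≮⇒≥ (λ 0<fi → none (i , 0<fi)))))) z≤n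

∑-mono-≤-rigid : ∀ {n} {f g : Fin n → ℕ} → (∀ i → f i ≤ g i) → sum g ≤ sum f → ∀ i → f i ≡ g i
∑-mono-≤-rigid {suc n} {f} {g} f≤g ∑g≤∑f = λ where
    zero    → ≤-antisym (f≤g zero) head≥
    (suc i) → ∑-mono-≤-rigid (f≤g ∘ suc) tail≥ i
  where
  head≥ : g zero ≤ f zero
  head≥ = +-cancelʳ-≤ _ _ _ (≤-trans (+-monoʳ-≤ (g zero) (∑-mono-≤ (f≤g ∘ suc))) ∑g≤∑f)
  tail≥ : sum (g ∘ suc) ≤ sum (f ∘ suc)
  tail≥ = +-cancelˡ-≤ (g zero) _ _ (≤-trans ∑g≤∑f (+-monoˡ-≤ _ (f≤g zero)))

∑-const-1 : ∀ n → ∑[ i < n ] 1 ≡ n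
∑-const-1 zero    = refl
∑-const-1 (suc n) = cong suc (∑-const-1 n)

∑∑-product : ∀ {m n} (f : Fin m → ℕ) (g : Fin n → ℕ) → ∑[ i < m ] ∑[ j < n ] (f i * g j) ≡ sum f * sum g
∑∑-product f g = begin
  ∑[ i < _ ] ∑[ j < _ ] (f i * g j) ≡⟨ sum-cong-≗ (λ i → *-distribˡ-sum (f i) g) ⟨
  ∑[ i < _ ] (f i * sum g)          ≡⟨ *-distribʳ-sum (sum g) f ⟨
  sum f * sum g                     ∎
  where open ≡-Reasoning

∑-linear : ∀ {n} a b (f g h : Fin n → ℕ) →
           ∑[ i < n ] (a * f i + b * (g i + h i)) ≡ a * sum f + b * (sum g + sum h)
∑-linear a b f g h = begin
  ∑[ i < _ ] (a * f i + b * (g i + h i))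
    ≡⟨ ∑-distrib-+ (λ i → a * f i) (λ i → b * (g i + h i)) ⟩
  ∑[ i < _ ] (a * f i) + ∑[ i < _ ] (b * (g i + h i))
    ≡⟨ cong₂ _+_ (*-distribˡ-sum a f) (*-distribˡ-sum b (λ i → g i + h i)) ⟨
  a * sum f + b * ∑[ i < _ ] (g i + h i)
    ≡⟨ cong (λ s → a * sum f + b * s) (∑-distrib-+ g h) ⟩
  a * sum f + b * (sum g + sum h)
    ∎
  where open ≡-Reasoning

sum-map-tabulate : ∀ {n} {A : Set} (f : A → ℕ) (g : Fin n → A) →
                   List.sum (List.map f (List.tabulate g)) ≡ sum (f ∘ g)
sum-map-tabulate {zero}  f g = refl
sum-map-tabulate {suc n} f g = cong (f (g zero) +_) (sum-map-tabulate f (g ∘ suc))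

δ : ∀ {n} → Fin n → Fin n → ℕ
δ p x = 𝟙 (does (p ≟ᶠ x))

δ-refl : ∀ {n} (p : Fin n) → δ p p ≡ 1
δ-refl p with p ≟ᶠ p
... | yes _   = refl
... | no p≢p = contradiction refl p≢p

δ-≢ : ∀ {n} {p x : Fin n} → p ≢ x → δ p x ≡ 0
δ-≢ {p = p} {x} p≢x with p ≟ᶠ x
... | yes p≡x = contradiction p≡x p≢x
... | no _    = refl

∑-δ : ∀ {n} (p : Fin n) (g : Fin n → ℕ) → ∑[ x < n ] (δ p x * g x) ≡ g p
∑-δ p g = begin
  ∑[ x < _ ] (δ p x * g x) ≡⟨ ∑-single p (λ x x≢p → cong (_* g x) (δ-≢ (x≢p ∘ sym))) ⟩
  δ p p * g p              ≡⟨ cong (_* g p) (δ-refl p) ⟩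
  1 * g p                  ≡⟨ *-identityˡ (g p) ⟩
  g p                      ∎
  where open ≡-Reasoning

δ+δ+δ≤1 : ∀ {n} {p q r x : Fin n} → p ≢ q → p ≢ r → q ≢ r → δ p x + δ q x + δ r x ≤ 1
δ+δ+δ≤1 {p = p} {q} {r} {x} p≢q p≢r q≢r with p ≟ᶠ x | q ≟ᶠ x | r ≟ᶠ x
... | yes refl | yes q≡x  | _         = contradiction (sym q≡x) p≢q
... | yes refl | _        | yes r≡x   = contradiction (sym r≡x) p≢r
... | _        | yes refl | yes r≡x   = contradiction (sym r≡x) q≢r
... | yes _    | no _     | no _      = ≤-refl
... | no _     | yes _    | no _      = ≤-refl
... | no _     | no _     | yes _     = ≤-refl
... | no _     | no _     | no _      = z≤n

δ+δ+δ-positive : ∀ {n} {p q r x : Fin n} → 0 < δ p x + δ q x + δ r x → x ≡ p ⊎ x ≡ q ⊎ x ≡ r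
δ+δ+δ-positive {p = p} {q} {r} {x} 0<δ with p ≟ᶠ x | q ≟ᶠ x | r ≟ᶠ x
... | yes p≡x | _       | _       = inj₁ (sym p≡x)
... | no _    | yes q≡x | _       = inj₂ (inj₁ (sym q≡x))
... | no _    | no _    | yes r≡x = inj₂ (inj₂ (sym r≡x))
... | no _    | no _    | no _    = contradiction 0<δ (<-irrefl refl)

χ : ∀ {n} → Subset n → Fin n → ℕ
χ p x = 𝟙 (does (x ∈? p))

χ≤1 : ∀ {n} (p : Subset n) x → χ p x ≤ 1
χ≤1 p x = 𝟙≤1 (does (x ∈? p))

χ*-mono-≤ : ∀ {n} (p : Subset n) x {a b} → (x ∈ p → a ≤ b) → χ p x * a ≤ χ p x * b
χ*-mono-≤ p x a≤b with x ∈? p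
... | yes x∈p = +-monoˡ-≤ 0 (a≤b x∈p)
... | no _    = z≤n

χ*-positive : ∀ {n} {p : Subset n} {x a} → 0 < χ p x * a → x ∈ p × 0 < a
χ*-positive {p = p} {x} {a} 0<χa with x ∈? p
... | yes x∈p = x∈p , subst (0 <_) (+-identityʳ a) 0<χa

χ*χ≡χ : ∀ {n} (p : Subset n) x → χ p x * χ p x ≡ χ p x
χ*χ≡χ p x with x ∈? p
... | yes _ = refl
... | no _  = refl

∣p∣≡∑χ : ∀ {n} (p : Subset n) → ∣ p ∣ ≡ sum (χ p)
∣p∣≡∑χ []            = refl
∣p∣≡∑χ (inside  ∷ p) = cong suc (∣p∣≡∑χ p)
∣p∣≡∑χ (outside ∷ p) = ∣p∣≡∑χ p

∑∑χχδ≡∣p∣ : ∀ {n} (p : Subset n) → ∑[ u < n ] ∑[ v < n ] (χ p u * (χ p v * δ u v)) ≡ ∣ p ∣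
∑∑χχδ≡∣p∣ {n} p = begin
  ∑[ u < n ] ∑[ v < n ] (χ p u * (χ p v * δ u v)) ≡⟨ sum-cong-≗ (λ u → *-distribˡ-sum (χ p u) (λ v → χ p v * δ u v)) ⟨
  ∑[ u < n ] (χ p u * ∑[ v < n ] (χ p v * δ u v)) ≡⟨ sum-cong-≗ (λ u → cong (χ p u *_) (∑χδ u)) ⟩
  ∑[ u < n ] (χ p u * χ p u)                      ≡⟨ sum-cong-≗ (χ*χ≡χ p) ⟩
  sum (χ p)                                       ≡⟨ ∣p∣≡∑χ p ⟨
  ∣ p ∣                                           ∎
  where
  open ≡-Reasoning
  ∑χδ : ∀ u → ∑[ v < n ] (χ p v * δ u v) ≡ χ p u
  ∑χδ u = trans (sum-cong-≗ (λ v → *-comm (χ p v) (δ u v))) (∑-δ u (χ p))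

-- Subsets

x∈p─q⇒x∉q : ∀ {n} {x : Fin n} (p q : Subset n) → x ∈ p ─ q → x ∉ q
x∈p─q⇒x∉q (_ ∷ p) (outside ∷ q) (there x∈p─q) (there x∈q) = x∈p─q⇒x∉q p q x∈p─q x∈q
x∈p─q⇒x∉q (_ ∷ p) (inside  ∷ q) (there x∈p─q) (there x∈q) = x∈p─q⇒x∉q p q x∈p─q x∈q

x∉p-x∪q : ∀ {n} {x : Fin n} (p : Subset n) {q} → x ∉ q → x ∉ (p - x) ∪ q
x∉p-x∪q {x = x} p x∉q x∈ with x∈p∪q⁻ (p - x) _ x∈
... | inj₁ x∈p-x = x∈p─q⇒x∉q p ⁅ x ⁆ x∈p-x (x∈⁅x⁆ x)
... | inj₂ x∈q   = x∉q x∈q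

x∈p∧y∉p⇒x∉⁅y⁆ : ∀ {n} {x y : Fin n} {p : Subset n} → x ∈ p → y ∉ p → x ∉ ⁅ y ⁆
x∈p∧y∉p⇒x∉⁅y⁆ {y = y} x∈p y∉p x∈⁅y⁆ = y∉p (subst (_∈ _) (x∈⁅y⁆⇒x≡y y x∈⁅y⁆) x∈p)

x∈p-y∪q : ∀ {n} {x y : Fin n} {p : Subset n} q → x ∈ p → x ≢ y → x ∈ (p - y) ∪ q
x∈p-y∪q q x∈p x≢y = x∈p∪q⁺ (inj₁ (x∈p∧x≢y⇒x∈p-y x∈p x≢y))

∣p∪q∣≤∣p∣+∣q∣ : ∀ {n} (p q : Subset n) → ∣ p ∪ q ∣ ≤ ∣ p ∣ + ∣ q ∣
∣p∪q∣≤∣p∣+∣q∣ []            []            = z≤n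
∣p∪q∣≤∣p∣+∣q∣ (inside  ∷ p) (s       ∷ q) = s≤s (≤-trans (∣p∪q∣≤∣p∣+∣q∣ p q) (+-monoʳ-≤ ∣ p ∣ (∣p∣≤∣x∷p∣ s q)))
∣p∪q∣≤∣p∣+∣q∣ (outside ∷ p) (inside  ∷ q) = ≤-trans (s≤s (∣p∪q∣≤∣p∣+∣q∣ p q)) (≤-reflexive (sym (+-suc ∣ p ∣ ∣ q ∣)))
∣p∪q∣≤∣p∣+∣q∣ (outside ∷ p) (outside ∷ q) = ∣p∪q∣≤∣p∣+∣q∣ p q

∣p-x∪⁅y⁆∣≤∣p∣ : ∀ {n} {p : Subset n} {x} y → x ∈ p → ∣ (p - x) ∪ ⁅ y ⁆ ∣ ≤ ∣ p ∣
∣p-x∪⁅y⁆∣≤∣p∣ {p = p} {x} y x∈p = begin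
  ∣ (p - x) ∪ ⁅ y ⁆ ∣   ≤⟨ ∣p∪q∣≤∣p∣+∣q∣ (p - x) ⁅ y ⁆ ⟩
  ∣ p - x ∣ + ∣ ⁅ y ⁆ ∣ ≡⟨ cong (∣ p - x ∣ +_) (∣⁅x⁆∣≡1 y) ⟩
  ∣ p - x ∣ + 1         ≡⟨ +-comm ∣ p - x ∣ 1 ⟩
  suc ∣ p - x ∣         ≤⟨ x∈p⇒∣p-x∣<∣p∣ x∈p ⟩
  ∣ p ∣                 ∎
  where open ≤-Reasoning

∣p-x-y∪⁅z⁆∪⁅w⁆∣≤∣p∣ : ∀ {n} {p : Subset n} {x y} z w → x ∈ p → y ∈ p → x ≢ y →
                      ∣ (p - x - y) ∪ ⁅ z ⁆ ∪ ⁅ w ⁆ ∣ ≤ ∣ p ∣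
∣p-x-y∪⁅z⁆∪⁅w⁆∣≤∣p∣ {p = p} {x} {y} z w x∈p y∈p x≢y = begin
  ∣ (p - x - y) ∪ ⁅ z ⁆ ∪ ⁅ w ⁆ ∣           ≤⟨ ∣p∪q∣≤∣p∣+∣q∣ (p - x - y) (⁅ z ⁆ ∪ ⁅ w ⁆) ⟩
  ∣ p - x - y ∣ + ∣ ⁅ z ⁆ ∪ ⁅ w ⁆ ∣         ≤⟨ +-monoʳ-≤ ∣ p - x - y ∣ (∣p∪q∣≤∣p∣+∣q∣ ⁅ z ⁆ ⁅ w ⁆) ⟩
  ∣ p - x - y ∣ + (∣ ⁅ z ⁆ ∣ + ∣ ⁅ w ⁆ ∣)   ≡⟨ cong (∣ p - x - y ∣ +_) (cong₂ _+_ (∣⁅x⁆∣≡1 z) (∣⁅x⁆∣≡1 w)) ⟩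
  ∣ p - x - y ∣ + 2                         ≡⟨ +-comm ∣ p - x - y ∣ 2 ⟩
  suc (suc ∣ p - x - y ∣)                   ≤⟨ s≤s (x∈p⇒∣p-x∣<∣p∣ (x∈p∧x≢y⇒x∈p-y y∈p (x≢y ∘ sym))) ⟩
  suc ∣ p - x ∣                             ≤⟨ x∈p⇒∣p-x∣<∣p∣ x∈p ⟩
  ∣ p ∣                                     ∎
  where open ≤-Reasoning

-- Halving

[2+n]/2≡1+n/2 : ∀ n → suc (suc n) / 2 ≡ suc (n / 2)
[2+n]/2≡1+n/2 n = m/n≡1+[m∸n]/n {suc (suc n)} {2} (s≤s (s≤s z≤n))

⌈n/2⌉+⌊n/2⌋≡n : ∀ n → ⌈ n /2⌉ + ⌊ n /2⌋ ≡ n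
⌈n/2⌉+⌊n/2⌋≡n zero          = refl
⌈n/2⌉+⌊n/2⌋≡n (suc zero)    = refl
⌈n/2⌉+⌊n/2⌋≡n (suc (suc n)) = begin
  suc (suc (suc n)) / 2 + suc (suc n) / 2 ≡⟨ cong₂ _+_ ([2+n]/2≡1+n/2 (suc n)) ([2+n]/2≡1+n/2 n) ⟩
  suc ⌈ n /2⌉ + suc ⌊ n /2⌋               ≡⟨ cong suc (+-suc ⌈ n /2⌉ ⌊ n /2⌋) ⟩
  2 + (⌈ n /2⌉ + ⌊ n /2⌋)                 ≡⟨ cong (2 +_) (⌈n/2⌉+⌊n/2⌋≡n n) ⟩
  suc (suc n)                             ∎
  where open ≡-Reasoning

m≤n⇒m≤⌊[m+n]/2⌋ : ∀ {m n} → m ≤ n → m ≤ ⌊ m + n /2⌋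
m≤n⇒m≤⌊[m+n]/2⌋ {m} {n} m≤n = begin
  m             ≡⟨ m*n/n≡m m 2 ⟨
  m * 2 / 2     ≡⟨ cong (_/ 2) (trans (*-comm m 2) (cong (m +_) (+-identityʳ m))) ⟩
  (m + m) / 2   ≤⟨ /-monoˡ-≤ 2 (+-monoʳ-≤ m m≤n) ⟩
  (m + n) / 2   ∎
  where open ≤-Reasoning

-- With c = ⌈(m + n)/2⌉ and f = ⌊(m + n)/2⌋ we have m ≤ f ≤ c; writing f = m + t gives n = c + t,
-- and m (c + t) ≤ c (m + t).
m≤n⇒m*n≤⌈[m+n]/2⌉*⌊[m+n]/2⌋ : ∀ {m n} → m ≤ n → m * n ≤ ⌈ m + n /2⌉ * ⌊ m + n /2⌋
m≤n⇒m*n≤⌈[m+n]/2⌉*⌊[m+n]/2⌋ {m} {n} m≤n = begin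
  m * n          ≡⟨ cong (m *_) n≡c+t ⟩
  m * (c + t)    ≡⟨ *-distribˡ-+ m c t ⟩
  m * c + m * t  ≤⟨ +-monoʳ-≤ (m * c) (*-monoˡ-≤ t m≤c) ⟩
  m * c + c * t  ≡⟨ cong (_+ c * t) (*-comm m c) ⟩
  c * m + c * t  ≡⟨ *-distribˡ-+ c m t ⟨
  c * (m + t)    ≡⟨ cong (c *_) m+t≡f ⟩
  c * f          ∎
  where
  open ≤-Reasoning
  c f t : ℕ
  c = ⌈ m + n /2⌉
  f = ⌊ m + n /2⌋
  t = f ∸ m
  m≤f : m ≤ f
  m≤f = m≤n⇒m≤⌊[m+n]/2⌋ m≤n
  m≤c : m ≤ c
  m≤c = ≤-trans m≤f (/-monoˡ-≤ 2 (n≤1+n (m + n)))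
  m+t≡f : m + t ≡ f
  m+t≡f = m+[n∸m]≡n m≤f
  n≡c+t : n ≡ c + t
  n≡c+t = +-cancelˡ-≡ m n (c + t) (begin-equality
    m + n        ≡⟨ ⌈n/2⌉+⌊n/2⌋≡n (m + n) ⟨
    c + f        ≡⟨ cong (c +_) m+t≡f ⟨
    c + (m + t)  ≡⟨ solve 3 (λ c m t → c :+ (m :+ t) := m :+ (c :+ t)) refl c m t ⟩
    m + (c + t)  ∎)

m*n≤⌈[m+n]/2⌉*⌊[m+n]/2⌋ : ∀ m n → m * n ≤ ⌈ m + n /2⌉ * ⌊ m + n /2⌋
m*n≤⌈[m+n]/2⌉*⌊[m+n]/2⌋ m n with ≤-total m n
... | inj₁ m≤n = m≤n⇒m*n≤⌈[m+n]/2⌉*⌊[m+n]/2⌋ m≤n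
... | inj₂ n≤m = subst₂ _≤_ (*-comm n m) (cong (λ s → ⌈ s /2⌉ * ⌊ s /2⌋) (+-comm n m))
                         (m≤n⇒m*n≤⌈[m+n]/2⌉*⌊[m+n]/2⌋ n≤m)

-- Graphs

module _ {n} (G : Graph n) where

  Adj-sym : ∀ {u v} → Adj G u v → Adj G v u
  Adj-sym {u} {v} = trans (Graph.sym G v u)

  Adj⇒≢ : ∀ {u v} → Adj G u v → u ≢ v
  Adj⇒≢ {u} uu refl with () ← trans (sym uu) (irref G u)

  Adj? : ∀ u v → Dec (Adj G u v)
  Adj? u v = adj G u v ≟ᵇ true

  ¬Adj⇒𝟙≡0 : ∀ {u v} → ¬ Adj G u v → 𝟙 (adj G u v) ≡ 0
  ¬Adj⇒𝟙≡0 {u} {v} ¬uv with adj G u v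
  ... | true  = contradiction refl ¬uv
  ... | false = refl

  ordered : Fin n → Fin n → ℕ
  ordered x y = 𝟙 (if toℕ x <ᵇ toℕ y then adj G x y else false)

  edgeCount≡∑∑ordered : edgeCount G ≡ ∑[ x < n ] ∑[ y < n ] ordered x y
  edgeCount≡∑∑ordered = trans (sum-map-tabulate row id) (sum-cong-≗ λ x →
    trans (cong (List.sum ∘ List.map 𝟙) (List.map-tabulate id (entry x))) (sum-map-tabulate 𝟙 (entry x)))
    where
    entry : Fin n → Fin n → Bool
    entry x y = if toℕ x <ᵇ toℕ y then adj G x y else false
    row : Fin n → ℕ
    row x = countTrue (List.map (entry x) (List.allFin n))

  𝟙adj≡ordered+ordered : ∀ x y → 𝟙 (adj G x y) ≡ ordered x y + ordered y x
  𝟙adj≡ordered+ordered x y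
    with toℕ x <ᵇ toℕ y | <ᵇ-reflects-< (toℕ x) (toℕ y) | toℕ y <ᵇ toℕ x | <ᵇ-reflects-< (toℕ y) (toℕ x)
  ... | true  | ofʸ x<y | true  | ofʸ y<x = contradiction y<x (<-asym x<y)
  ... | true  | _       | false | _       = sym (+-identityʳ _)
  ... | false | _       | true  | _       = cong 𝟙 (Graph.sym G x y)
  ... | false | ofⁿ x≮y | false | ofⁿ y≮x = ¬Adj⇒𝟙≡0 (λ xy → Adj⇒≢ xy x≡y)
    where
    x≡y : x ≡ y
    x≡y = toℕ-injective (≤-antisym (≮⇒≥ y≮x) (≮⇒≥ x≮y))

  handshake : ∑[ x < n ] ∑[ y < n ] 𝟙 (adj G x y) ≡ edgeCount G + edgeCount G
  handshake = begin
    ∑[ x < n ] ∑[ y < n ] 𝟙 (adj G x y)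
      ≡⟨ sum-cong-≗ (λ x → trans (sum-cong-≗ (𝟙adj≡ordered+ordered x)) (∑-distrib-+ (ordered x) (λ y → ordered y x))) ⟩
    ∑[ x < n ] (∑[ y < n ] ordered x y + ∑[ y < n ] ordered y x)
      ≡⟨ ∑-distrib-+ (λ x → ∑[ y < n ] ordered x y) (λ x → ∑[ y < n ] ordered y x) ⟩
    ∑[ x < n ] ∑[ y < n ] ordered x y + ∑[ x < n ] ∑[ y < n ] ordered y x
      ≡⟨ cong (∑[ x < n ] ∑[ y < n ] ordered x y +_) (∑-comm (λ x y → ordered y x)) ⟩
    ∑[ x < n ] ∑[ y < n ] ordered x y + ∑[ y < n ] ∑[ x < n ] ordered y x
      ≡⟨ cong₂ _+_ edgeCount≡∑∑ordered edgeCount≡∑∑ordered ⟨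
    edgeCount G + edgeCount G
      ∎
    where open ≡-Reasoning

module UniqueMinimumDominatingSet {n} (G : Graph n) (D : Subset n)
  (D-dominating : Dominating G D)
  (D-unique : ∀ E → Dominating G E → ∣ E ∣ ≤ ∣ D ∣ → E ≡ D) where

  record PrivateNeighbour (u z : Fin n) : Set where
    constructor private-neighbour
    field
      outside-D      : z ∉ D
      adjacent       : Adj G u z
      only-dominator : ∀ w → w ∈ D → Adj G w z → w ≡ u

  open PrivateNeighbour

  private-neighbour? : ∀ u z → Dec (PrivateNeighbour u z)
  private-neighbour? u z =
    map′ (λ (z∉D , uz , only) → private-neighbour z∉D uz only) (λ p → outside-D p , adjacent p , only-dominator p)
         (¬? (z ∈? D) ×-dec Adj? G u z ×-dec all? (λ w → w ∈? D →-dec Adj? G w z →-dec w ≟ᶠ u))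

  PrivatePair : Fin n → Fin n → Fin n → Set
  PrivatePair u a b = a ≢ b × PrivateNeighbour u a × PrivateNeighbour u b

  shared-dominator : ∀ {u z} → z ∉ D → Adj G u z → ¬ PrivateNeighbour u z →
                     ∃[ w ] (w ∈ D × Adj G w z × w ≢ u)
  shared-dominator {u} {z} z∉D uz ¬private with any? (λ w → w ∈? D ×-dec Adj? G w z ×-dec ¬? (w ≟ᶠ u))
  ... | yes found = found
  ... | no none   = contradiction (private-neighbour z∉D uz λ w w∈D wz →
                      decidable-stable (w ≟ᶠ u) (λ w≢u → none (w , w∈D , wz , w≢u))) ¬private

  D⊆dominating : ∀ {E} → Dominating G E → ∣ E ∣ ≤ ∣ D ∣ → D ⊆ E
  D⊆dominating E-dominating E-small = subst (_ ∈_) (sym (D-unique _ E-dominating E-small))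

  cannot-exchange-for-neighbour : ∀ {u x} → u ∈ D → Adj G x u →
                                  (∀ z → z ≢ x → ¬ PrivateNeighbour u z) → ⊥
  cannot-exchange-for-neighbour {u} {x} u∈D xu only-x =
    x∉p-x∪q D (Adj⇒≢ G xu ∘ sym ∘ x∈⁅y⁆⇒x≡y x) (D⊆dominating E-dominating (∣p-x∪⁅y⁆∣≤∣p∣ x u∈D) u∈D)
    where
    E : Subset n
    E = (D - u) ∪ ⁅ x ⁆
    x∈E : x ∈ E
    x∈E = x∈p∪q⁺ (inj₂ (x∈⁅x⁆ x))
    E-dominating : Dominating G E
    E-dominating z z∉E with z ≟ᶠ u
    ... | yes refl = x , x∈E , xu
    ... | no z≢u with z ∈? D
    ...   | yes z∈D = contradiction (x∈p-y∪q ⁅ x ⁆ z∈D z≢u) z∉E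
    ...   | no z∉D with D-dominating z z∉D
    ...     | w , w∈D , wz with w ≟ᶠ u
    ...       | no w≢u  = w , x∈p-y∪q ⁅ x ⁆ w∈D w≢u , wz
    ...       | yes refl =
                let z≢x = λ z≡x → z∉E (subst (_∈ E) (sym z≡x) x∈E)
                    w′ , w′∈D , w′z , w′≢u = shared-dominator z∉D wz (only-x z z≢x)
                in w′ , x∈p-y∪q ⁅ x ⁆ w′∈D w′≢u , w′z

  private-pair : NoIsolated G → ∀ {u} → u ∈ D → ∃[ a ] ∃[ b ] PrivatePair u a b
  private-pair no-isolated {u} u∈D with any? (private-neighbour? u)
  ... | no none =
        let x , xu = no-isolated u
        in ⊥-elim (cannot-exchange-for-neighbour u∈D xu (λ z _ z-private → none (z , z-private)))
  ... | yes (a , a-private) with any? (λ b → ¬? (a ≟ᶠ b) ×-dec private-neighbour? u b)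
  ...   | yes (b , a≢b , b-private) = a , b , a≢b , a-private , b-private
  ...   | no none = ⊥-elim (cannot-exchange-for-neighbour u∈D (Adj-sym G (adjacent a-private))
                      (λ z z≢a z-private → none (z , z≢a ∘ sym , z-private)))

  private-pairs : NoIsolated G →
                  Σ[ A ∈ (Fin n → Fin n) ] Σ[ B ∈ (Fin n → Fin n) ] (∀ {u} → u ∈ D → PrivatePair u (A u) (B u))
  private-pairs no-isolated = (λ u → proj₁ (pair u)) , (λ u → proj₁ (proj₂ (pair u))) , λ {u} → proj₂ (proj₂ (pair u))
    where
    pair : ∀ u → ∃[ a ] ∃[ b ] (u ∈ D → PrivatePair u a b)
    pair u with u ∈? D
    ... | yes u∈D = let a , b , ab = private-pair no-isolated u∈D in a , b , λ _ → ab
    ... | no u∉D  = u , u , λ u∈D → contradiction u∈D u∉D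

  module Blocks (A B : Fin n → Fin n) (pair : ∀ {u} → u ∈ D → PrivatePair u (A u) (B u))
                (n≡3∣D∣ : n ≡ 3 * ∣ D ∣) where

    Block : Fin n → Fin n → Set
    Block u z = z ≡ u ⊎ z ≡ A u ⊎ z ≡ B u

    blockSum : Fin n → (Fin n → ℕ) → ℕ
    blockSum u h = h u + h (A u) + h (B u)

    private-in-block : ∀ {u z} → u ∈ D → z ≡ A u ⊎ z ≡ B u → PrivateNeighbour u z
    private-in-block u∈D (inj₁ refl) = proj₁ (proj₂ (pair u∈D))
    private-in-block u∈D (inj₂ refl) = proj₂ (proj₂ (pair u∈D))

    A-private : ∀ {u} → u ∈ D → PrivateNeighbour u (A u)
    A-private u∈D = private-in-block u∈D (inj₁ refl)

    B-private : ∀ {u} → u ∈ D → PrivateNeighbour u (B u)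
    B-private u∈D = private-in-block u∈D (inj₂ refl)

    ¬Adj-private : ∀ {u v z} → u ∈ D → u ≢ v → PrivateNeighbour v z → ¬ Adj G u z
    ¬Adj-private u∈D u≢v z-private uz = u≢v (only-dominator z-private _ u∈D uz)

    blocks-disjoint : ∀ {u v z} → u ∈ D → v ∈ D → Block u z → Block v z → u ≡ v
    blocks-disjoint u∈D v∈D (inj₁ refl) (inj₁ refl) = refl
    blocks-disjoint u∈D v∈D (inj₁ refl) (inj₂ z∈v)  = contradiction u∈D (outside-D (private-in-block v∈D z∈v))
    blocks-disjoint u∈D v∈D (inj₂ z∈u)  (inj₁ refl) = contradiction v∈D (outside-D (private-in-block u∈D z∈u))
    blocks-disjoint u∈D v∈D (inj₂ z∈u)  (inj₂ z∈v)  =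
      sym (only-dominator (private-in-block u∈D z∈u) _ v∈D (adjacent (private-in-block v∈D z∈v)))

    multiplicity : Fin n → Fin n → ℕ
    multiplicity u z = χ D u * (δ u z + δ (A u) z + δ (B u) z)

    multiplicity≤1 : ∀ u z → multiplicity u z ≤ 1
    multiplicity≤1 u z = ≤-trans (χ*-mono-≤ D u distinct) (≤-trans (≤-reflexive (*-identityʳ (χ D u))) (χ≤1 D u))
      where
      distinct : u ∈ D → δ u z + δ (A u) z + δ (B u) z ≤ 1
      distinct u∈D = δ+δ+δ≤1 (Adj⇒≢ G (adjacent (A-private u∈D))) (Adj⇒≢ G (adjacent (B-private u∈D)))
                              (proj₁ (pair u∈D))

    multiplicity-positive : ∀ {u z} → 0 < multiplicity u z → u ∈ D × Block u z
    multiplicity-positive 0<m = let u∈D , 0<δ = χ*-positive 0<m in u∈D , δ+δ+δ-positive 0<δ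

    ∑-multiplicity : ∀ u h → ∑[ z < n ] (multiplicity u z * h z) ≡ χ D u * blockSum u h
    ∑-multiplicity u h = begin
      ∑[ z < n ] (χ D u * (δ u z + δ (A u) z + δ (B u) z) * h z)
        ≡⟨ sum-cong-≗ (λ z → solve 5 (λ c d₁ d₂ d₃ x → c :* (d₁ :+ d₂ :+ d₃) :* x
                                                      := c :* (d₁ :* x :+ d₂ :* x :+ d₃ :* x))
                                       refl (χ D u) (δ u z) (δ (A u) z) (δ (B u) z) (h z)) ⟩
      ∑[ z < n ] (χ D u * (δ u z * h z + δ (A u) z * h z + δ (B u) z * h z))
        ≡⟨ *-distribˡ-sum (χ D u) (λ z → δ u z * h z + δ (A u) z * h z + δ (B u) z * h z) ⟨
      χ D u * ∑[ z < n ] (δ u z * h z + δ (A u) z * h z + δ (B u) z * h z)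
        ≡⟨ cong (χ D u *_) (trans (∑-distrib-+ (λ z → δ u z * h z + δ (A u) z * h z) (λ z → δ (B u) z * h z))
                                  (cong (_+ _) (∑-distrib-+ (λ z → δ u z * h z) (λ z → δ (A u) z * h z)))) ⟩
      χ D u * (∑[ z < n ] (δ u z * h z) + ∑[ z < n ] (δ (A u) z * h z) + ∑[ z < n ] (δ (B u) z * h z))
        ≡⟨ cong (χ D u *_) (cong₂ _+_ (cong₂ _+_ (∑-δ u h) (∑-δ (A u) h)) (∑-δ (B u) h)) ⟩
      χ D u * blockSum u h
        ∎
      where open ≡-Reasoning

    -- The γ blocks are pairwise disjoint and have 3γ = n elements in total.
    blocks-cover : ∀ z → ∑[ u < n ] multiplicity u z ≡ 1
    blocks-cover = ∑-mono-≤-rigid {g = λ _ → 1} at-most-once (≤-reflexive total)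
      where
      at-most-once : ∀ z → ∑[ u < n ] multiplicity u z ≤ 1
      at-most-once z = ∑-≤1 _ (λ u → multiplicity≤1 u z) λ u v 0<mu 0<mv →
        let u∈D , z∈u = multiplicity-positive 0<mu
            v∈D , z∈v = multiplicity-positive 0<mv
        in blocks-disjoint u∈D v∈D z∈u z∈v
      total : ∑[ z < n ] 1 ≡ ∑[ z < n ] ∑[ u < n ] multiplicity u z
      total = begin
        ∑[ z < n ] 1                                 ≡⟨ ∑-const-1 n ⟩
        n                                            ≡⟨ n≡3∣D∣ ⟩
        3 * ∣ D ∣                                    ≡⟨ cong (3 *_) (∣p∣≡∑χ D) ⟩
        3 * sum (χ D)                                ≡⟨ *-comm 3 (sum (χ D)) ⟩
        sum (χ D) * 3                                ≡⟨ *-distribʳ-sum 3 (χ D) ⟩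
        ∑[ u < n ] (χ D u * blockSum u (λ _ → 1))    ≡⟨ sum-cong-≗ (λ u → ∑-multiplicity u (λ _ → 1)) ⟨
        ∑[ u < n ] ∑[ z < n ] (multiplicity u z * 1) ≡⟨ sum-cong-≗ (λ u → sum-cong-≗ (*-identityʳ ∘ multiplicity u)) ⟩
        ∑[ u < n ] ∑[ z < n ] multiplicity u z       ≡⟨ ∑-comm multiplicity ⟩
        ∑[ z < n ] ∑[ u < n ] multiplicity u z       ∎
        where open ≡-Reasoning

    in-some-block : ∀ z → ∃[ u ] (u ∈ D × Block u z)
    in-some-block z =
      let u , 0<mu = ∑-positive⇒∃ (λ u → multiplicity u z) (subst (0 <_) (sym (blocks-cover z)) (s≤s z≤n))
      in u , multiplicity-positive 0<mu

    private-neighbours-exhaust : ∀ {u z} → u ∈ D → z ∉ D → Adj G u z → z ≡ A u ⊎ z ≡ B u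
    private-neighbours-exhaust {u} {z} u∈D z∉D uz = owner-of (in-some-block z)
      where
      owner-of : ∃[ w ] (w ∈ D × Block w z) → z ≡ A u ⊎ z ≡ B u
      owner-of (w , w∈D , inj₁ z≡w) = contradiction (subst (_∈ D) (sym z≡w) w∈D) z∉D
      owner-of (w , w∈D , inj₂ z∈w) =
        subst (λ w → z ≡ A w ⊎ z ≡ B w) (sym (only-dominator (private-in-block w∈D z∈w) u u∈D uz)) z∈w

    dominating-if-blocks-dominated :
      ∀ E → (∀ {u z} → u ∈ D → u ∉ E → Block u z → z ∉ E → ∃[ w ] (w ∈ E × Adj G w z)) → Dominating G E
    dominating-if-blocks-dominated E blocks-dominated z z∉E with z ∈? D
    ... | yes z∈D = blocks-dominated z∈D z∉E (inj₁ refl) z∉E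
    ... | no z∉D with D-dominating z z∉D
    ...   | w , w∈D , wz with w ∈? E
    ...     | yes w∈E = w , w∈E , wz
    ...     | no w∉E  = blocks-dominated w∈D w∉E (inj₂ (private-neighbours-exhaust w∈D z∉D wz)) z∉E

    cannot-trade-block-for-one : ∀ {u v p} → u ∈ D → v ∈ D → u ≢ v → Adj G u v → p ∉ D →
                                 Adj G p (A v) → Adj G p (B v) → ⊥
    cannot-trade-block-for-one {u} {v} {p} u∈D v∈D u≢v uv p∉D pA pB =
      x∉p-x∪q D (x∈p∧y∉p⇒x∉⁅y⁆ v∈D p∉D) (D⊆dominating E-dominating (∣p-x∪⁅y⁆∣≤∣p∣ p v∈D) v∈D)
      where
      E : Subset n
      E = (D - v) ∪ ⁅ p ⁆
      p∈E : p ∈ E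
      p∈E = x∈p∪q⁺ (inj₂ (x∈⁅x⁆ p))
      dominated : ∀ {z} → Block v z → ∃[ w ] (w ∈ E × Adj G w z)
      dominated (inj₁ refl)        = u , x∈p-y∪q ⁅ p ⁆ u∈D u≢v , uv
      dominated (inj₂ (inj₁ refl)) = p , p∈E , pA
      dominated (inj₂ (inj₂ refl)) = p , p∈E , pB
      E-dominating : Dominating G E
      E-dominating = dominating-if-blocks-dominated E λ {w} {z} w∈D w∉E z∈w _ →
        let w≡v = decidable-stable (w ≟ᶠ v) (λ w≢v → w∉E (x∈p-y∪q ⁅ p ⁆ w∈D w≢v))
        in dominated (subst (λ w → Block w z) w≡v z∈w)

    DominatedByPair : Fin n → Fin n → Fin n → Set
    DominatedByPair p q z = z ≡ p ⊎ z ≡ q ⊎ Adj G p z ⊎ Adj G q z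

    cannot-trade-two-blocks : ∀ {u v p q} → u ∈ D → v ∈ D → u ≢ v → p ∉ D → q ∉ D →
                              (∀ {z} → Block u z ⊎ Block v z → DominatedByPair p q z) → ⊥
    cannot-trade-two-blocks {u} {v} {p} {q} u∈D v∈D u≢v p∉D q∉D pair-dominates =
      x∉p-x∪q (D - v) u∉⁅p⁆∪⁅q⁆ (D⊆dominating E-dominating (∣p-x-y∪⁅z⁆∪⁅w⁆∣≤∣p∣ p q v∈D u∈D (u≢v ∘ sym)) u∈D)
      where
      E : Subset n
      E = (D - v - u) ∪ ⁅ p ⁆ ∪ ⁅ q ⁆
      u∉⁅p⁆∪⁅q⁆ : u ∉ ⁅ p ⁆ ∪ ⁅ q ⁆
      u∉⁅p⁆∪⁅q⁆ u∈ = [ x∈p∧y∉p⇒x∉⁅y⁆ u∈D p∉D , x∈p∧y∉p⇒x∉⁅y⁆ u∈D q∉D ]′ (x∈p∪q⁻ ⁅ p ⁆ ⁅ q ⁆ u∈)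
      p∈E : p ∈ E
      p∈E = x∈p∪q⁺ (inj₂ (x∈p∪q⁺ (inj₁ (x∈⁅x⁆ p))))
      q∈E : q ∈ E
      q∈E = x∈p∪q⁺ (inj₂ (x∈p∪q⁺ (inj₂ (x∈⁅x⁆ q))))
      traded : ∀ {w} → w ∈ D → w ∉ E → w ≡ u ⊎ w ≡ v
      traded {w} w∈D w∉E with w ≟ᶠ u | w ≟ᶠ v
      ... | yes w≡u | _       = inj₁ w≡u
      ... | no _    | yes w≡v = inj₂ w≡v
      ... | no w≢u  | no w≢v  = contradiction (x∈p-y∪q (⁅ p ⁆ ∪ ⁅ q ⁆) (x∈p∧x≢y⇒x∈p-y w∈D w≢v) w≢u) w∉E
      dominated : ∀ {z} → z ∉ E → DominatedByPair p q z → ∃[ w ] (w ∈ E × Adj G w z)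
      dominated z∉E (inj₁ refl)               = contradiction p∈E z∉E
      dominated z∉E (inj₂ (inj₁ refl))        = contradiction q∈E z∉E
      dominated z∉E (inj₂ (inj₂ (inj₁ pz)))   = p , p∈E , pz
      dominated z∉E (inj₂ (inj₂ (inj₂ qz)))   = q , q∈E , qz
      E-dominating : Dominating G E
      E-dominating = dominating-if-blocks-dominated E λ {w} {z} w∈D w∉E z∈w z∉E →
        dominated z∉E (pair-dominates (⊎.map (λ w≡u → subst (λ w → Block w z) w≡u z∈w)
                                               (λ w≡v → subst (λ w → Block w z) w≡v z∈w)
                                               (traded w∈D w∉E)))

    blockSum-cong : ∀ u {h k : Fin n → ℕ} → (∀ x → h x ≡ k x) → blockSum u h ≡ blockSum u k
    blockSum-cong u h≗k = cong₂ _+_ (cong₂ _+_ (h≗k u) (h≗k (A u))) (h≗k (B u))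

    blockSum-∑ : ∀ u (g : Fin n → Fin n → ℕ) →
                 blockSum u (λ x → ∑[ v < n ] g x v) ≡ ∑[ v < n ] blockSum u (λ x → g x v)
    blockSum-∑ u g = sym (trans (∑-distrib-+ (λ v → g u v + g (A u) v) (g (B u)))
                                (cong (_+ sum (g (B u))) (∑-distrib-+ (g u) (g (A u)))))

    blockSum-*ˡ : ∀ u k (h : Fin n → ℕ) → blockSum u (λ x → k * h x) ≡ k * blockSum u h
    blockSum-*ˡ u k h =
      solve 4 (λ k x y z → k :* x :+ k :* y :+ k :* z := k :* (x :+ y :+ z)) refl k (h u) (h (A u)) (h (B u))

    ∑-by-blocks : ∀ h → sum h ≡ ∑[ u < n ] (χ D u * blockSum u h)
    ∑-by-blocks h = begin
      ∑[ z < n ] h z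
        ≡⟨ sum-cong-≗ (λ z → trans (cong (_* h z) (blocks-cover z)) (*-identityˡ (h z))) ⟨
      ∑[ z < n ] (∑[ u < n ] multiplicity u z * h z)
        ≡⟨ sum-cong-≗ (λ z → *-distribʳ-sum (h z) (λ u → multiplicity u z)) ⟩
      ∑[ z < n ] ∑[ u < n ] (multiplicity u z * h z)
        ≡⟨ ∑-comm (λ z u → multiplicity u z * h z) ⟩
      ∑[ u < n ] ∑[ z < n ] (multiplicity u z * h z)
        ≡⟨ sum-cong-≗ (λ u → ∑-multiplicity u h) ⟩
      ∑[ u < n ] (χ D u * blockSum u h)
        ∎
      where open ≡-Reasoning

    ∑∑-by-blocks : ∀ (f : Fin n → Fin n → ℕ) → ∑[ x < n ] ∑[ y < n ] f x y ≡
                   ∑[ u < n ] ∑[ v < n ] (χ D u * (χ D v * blockSum u (λ x → blockSum v (f x))))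
    ∑∑-by-blocks f = begin
      ∑[ x < n ] ∑[ y < n ] f x y
        ≡⟨ ∑-by-blocks (λ x → ∑[ y < n ] f x y) ⟩
      ∑[ u < n ] (χ D u * blockSum u (λ x → ∑[ y < n ] f x y))
        ≡⟨ sum-cong-≗ (λ u → cong (χ D u *_) (blockSum-cong u (λ x → ∑-by-blocks (f x)))) ⟩
      ∑[ u < n ] (χ D u * blockSum u (λ x → ∑[ v < n ] (χ D v * blockSum v (f x))))
        ≡⟨ sum-cong-≗ (λ u → cong (χ D u *_) (blockSum-∑ u (λ x v → χ D v * blockSum v (f x)))) ⟩
      ∑[ u < n ] (χ D u * ∑[ v < n ] blockSum u (λ x → χ D v * blockSum v (f x)))
        ≡⟨ sum-cong-≗ (λ u → cong (χ D u *_) (sum-cong-≗ (λ v → blockSum-*ˡ u (χ D v) (λ x → blockSum v (f x))))) ⟩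
      ∑[ u < n ] (χ D u * ∑[ v < n ] (χ D v * blockSum u (λ x → blockSum v (f x))))
        ≡⟨ sum-cong-≗ (λ u → *-distribˡ-sum (χ D u) (λ v → χ D v * blockSum u (λ x → blockSum v (f x)))) ⟩
      ∑[ u < n ] ∑[ v < n ] (χ D u * (χ D v * blockSum u (λ x → blockSum v (f x))))
        ∎
      where open ≡-Reasoning

    cannot-match-AA-BB : ∀ {u v} → u ∈ D → v ∈ D → u ≢ v → ¬ (Adj G (A u) (A v) × Adj G (B u) (B v))
    cannot-match-AA-BB {u} {v} u∈D v∈D u≢v (AA , BB) =
      cannot-trade-two-blocks u∈D v∈D u≢v (outside-D (A-private u∈D)) (outside-D (B-private v∈D)) λ where
        (inj₁ (inj₁ refl))        → inj₂ (inj₂ (inj₁ (Adj-sym G (adjacent (A-private u∈D)))))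
        (inj₁ (inj₂ (inj₁ refl))) → inj₁ refl
        (inj₁ (inj₂ (inj₂ refl))) → inj₂ (inj₂ (inj₂ (Adj-sym G BB)))
        (inj₂ (inj₁ refl))        → inj₂ (inj₂ (inj₂ (Adj-sym G (adjacent (B-private v∈D)))))
        (inj₂ (inj₂ (inj₁ refl))) → inj₂ (inj₂ (inj₁ AA))
        (inj₂ (inj₂ (inj₂ refl))) → inj₂ (inj₁ refl)

    cannot-match-AB-BA : ∀ {u v} → u ∈ D → v ∈ D → u ≢ v → ¬ (Adj G (A u) (B v) × Adj G (B u) (A v))
    cannot-match-AB-BA {u} {v} u∈D v∈D u≢v (AB , BA) =
      cannot-trade-two-blocks u∈D v∈D u≢v (outside-D (A-private u∈D)) (outside-D (A-private v∈D)) λ where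
        (inj₁ (inj₁ refl))        → inj₂ (inj₂ (inj₁ (Adj-sym G (adjacent (A-private u∈D)))))
        (inj₁ (inj₂ (inj₁ refl))) → inj₁ refl
        (inj₁ (inj₂ (inj₂ refl))) → inj₂ (inj₂ (inj₂ (Adj-sym G BA)))
        (inj₂ (inj₁ refl))        → inj₂ (inj₂ (inj₂ (Adj-sym G (adjacent (A-private v∈D)))))
        (inj₂ (inj₂ (inj₁ refl))) → inj₂ (inj₁ refl)
        (inj₂ (inj₂ (inj₂ refl))) → inj₂ (inj₂ (inj₁ AB))

    between : Fin n → Fin n → ℕ
    between u v = blockSum u (λ x → blockSum v (λ y → 𝟙 (adj G x y)))

    between-≤ : ∀ {u v a₁ a₂ a₃ a₄ a₅ a₆ a₇ a₈ a₉} →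
      𝟙 (adj G u v)     ≤ a₁ → 𝟙 (adj G u (A v))     ≤ a₂ → 𝟙 (adj G u (B v))     ≤ a₃ →
      𝟙 (adj G (A u) v) ≤ a₄ → 𝟙 (adj G (A u) (A v)) ≤ a₅ → 𝟙 (adj G (A u) (B v)) ≤ a₆ →
      𝟙 (adj G (B u) v) ≤ a₇ → 𝟙 (adj G (B u) (A v)) ≤ a₈ → 𝟙 (adj G (B u) (B v)) ≤ a₉ →
      between u v ≤ a₁ + a₂ + a₃ + (a₄ + a₅ + a₆) + (a₇ + a₈ + a₉)
    between-≤ b₁ b₂ b₃ b₄ b₅ b₆ b₇ b₈ b₉ =
      +-mono-≤ (+-mono-≤ (+-mono-≤ (+-mono-≤ b₁ b₂) b₃) (+-mono-≤ (+-mono-≤ b₄ b₅) b₆)) (+-mono-≤ (+-mono-≤ b₇ b₈) b₉)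

    no-edge : ∀ {x y} → ¬ Adj G x y → 𝟙 (adj G x y) ≤ 0
    no-edge = ≤-reflexive ∘ ¬Adj⇒𝟙≡0 G

    module DistinctBlocks {u v} (u∈D : u ∈ D) (v∈D : v ∈ D) (u≢v : u ≢ v) where

      no-edge-to-pair : ∀ {z} → z ≡ A v ⊎ z ≡ B v → 𝟙 (adj G u z) ≤ 0
      no-edge-to-pair z∈ = no-edge (¬Adj-private u∈D u≢v (private-in-block v∈D z∈))

      no-edge-from-pair : ∀ {z} → z ≡ A u ⊎ z ≡ B u → 𝟙 (adj G z v) ≤ 0
      no-edge-from-pair z∈ = no-edge (¬Adj-private v∈D (u≢v ∘ sym) (private-in-block u∈D z∈) ∘ Adj-sym G)

      between-distinct : between u v ≤ 2
      between-distinct = ≤-trans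
        (between-≤ ≤-refl                          (no-edge-to-pair (inj₁ refl)) (no-edge-to-pair (inj₂ refl))
                   (no-edge-from-pair (inj₁ refl)) ≤-refl                        ≤-refl
                   (no-edge-from-pair (inj₂ refl)) ≤-refl                        ≤-refl)
        (at-most-two-of-five (adj G u v) (adj G (A u) (A v)) (adj G (A u) (B v)) (adj G (B u) (A v)) (adj G (B u) (B v))
          (cannot-match-AA-BB u∈D v∈D u≢v) (cannot-match-AB-BA u∈D v∈D u≢v)
          (λ uv (AA , AB) → trade-v uv (outside-D (A-private u∈D)) AA AB)
          (λ uv (BA , BB) → trade-v uv (outside-D (B-private u∈D)) BA BB)
          (λ uv (AA , BA) → trade-u uv (outside-D (A-private v∈D)) (Adj-sym G AA) (Adj-sym G BA))
          (λ uv (AB , BB) → trade-u uv (outside-D (B-private v∈D)) (Adj-sym G AB) (Adj-sym G BB)))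
        where
        trade-v : ∀ {p} → Adj G u v → p ∉ D → Adj G p (A v) → Adj G p (B v) → ⊥
        trade-v = cannot-trade-block-for-one u∈D v∈D u≢v
        trade-u : ∀ {p} → Adj G u v → p ∉ D → Adj G p (A u) → Adj G p (B u) → ⊥
        trade-u uv = cannot-trade-block-for-one v∈D u∈D (u≢v ∘ sym) (Adj-sym G uv)

    module TwoColoured (c : Fin n → Bool) (proper : ∀ u v → Adj G u v → c u ≢ c v) where

      pair-colour : ∀ {u z} → u ∈ D → z ≡ A u ⊎ z ≡ B u → c z ≡ not (c u)
      pair-colour u∈D z∈ = ¬-not (proper _ _ (adjacent (private-in-block u∈D z∈)) ∘ sym)

      monochromatic : ∀ {x y} → c x ≡ c y → 𝟙 (adj G x y) ≤ 0
      monochromatic cx≡cy = no-edge (λ xy → proper _ _ xy cx≡cy)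

      between-diagonal : ∀ {u} → u ∈ D → between u u ≤ 4
      between-diagonal {u} u∈D =
        between-≤ (loop u) (𝟙≤1 _)                             (𝟙≤1 _)
                  (𝟙≤1 _)  (loop (A u))                        (within-pair (inj₁ refl) (inj₂ refl))
                  (𝟙≤1 _)  (within-pair (inj₂ refl) (inj₁ refl)) (loop (B u))
        where
        loop : ∀ x → 𝟙 (adj G x x) ≤ 0
        loop x = ≤-reflexive (cong 𝟙 (irref G x))
        within-pair : ∀ {x y} → x ≡ A u ⊎ x ≡ B u → y ≡ A u ⊎ y ≡ B u → 𝟙 (adj G x y) ≤ 0
        within-pair x∈ y∈ = monochromatic (trans (pair-colour u∈D x∈) (sym (pair-colour u∈D y∈)))

      between-same-colour : ∀ {u v} → u ∈ D → v ∈ D → u ≢ v → c u ≡ c v → between u v ≤ 0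
      between-same-colour {u} {v} u∈D v∈D u≢v cu≡cv =
        between-≤ (monochromatic cu≡cv)          (no-edge-to-pair (inj₁ refl))    (no-edge-to-pair (inj₂ refl))
                  (no-edge-from-pair (inj₁ refl)) (across (inj₁ refl) (inj₁ refl)) (across (inj₁ refl) (inj₂ refl))
                  (no-edge-from-pair (inj₂ refl)) (across (inj₂ refl) (inj₁ refl)) (across (inj₂ refl) (inj₂ refl))
        where
        open DistinctBlocks u∈D v∈D u≢v
        across : ∀ {x y} → x ≡ A u ⊎ x ≡ B u → y ≡ A v ⊎ y ≡ B v → 𝟙 (adj G x y) ≤ 0
        across x∈ y∈ = monochromatic (trans (pair-colour u∈D x∈) (trans (cong not cu≡cv) (sym (pair-colour v∈D y∈))))

      between≤ : ∀ {u v} → u ∈ D → v ∈ D → between u v ≤ 4 * δ u v + 2 * 𝟙 (c u xor c v)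
      between≤ {u} {v} u∈D v∈D with u ≟ᶠ v
      ... | yes refl = ≤-trans (between-diagonal u∈D) (m≤m+n 4 _)
      ... | no u≢v with c u in cu | c v in cv
      ...   | true  | true  = between-same-colour u∈D v∈D u≢v (trans cu (sym cv))
      ...   | false | false = between-same-colour u∈D v∈D u≢v (trans cu (sym cv))
      ...   | true  | false = DistinctBlocks.between-distinct u∈D v∈D u≢v
      ...   | false | true  = DistinctBlocks.between-distinct u∈D v∈D u≢v

      red blue : Fin n → ℕ
      red  u = χ D u * 𝟙 (c u)
      blue u = χ D u * 𝟙 (not (c u))

      ∑red+∑blue≡∣D∣ : sum red + sum blue ≡ ∣ D ∣
      ∑red+∑blue≡∣D∣ = begin
        sum red + sum blue          ≡⟨ ∑-distrib-+ red blue ⟨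
        ∑[ u < n ] (red u + blue u) ≡⟨ sum-cong-≗ χ-split ⟩
        sum (χ D)                   ≡⟨ ∣p∣≡∑χ D ⟨
        ∣ D ∣                       ∎
        where
        open ≡-Reasoning
        χ-split : ∀ u → red u + blue u ≡ χ D u
        χ-split u = begin
          χ D u * 𝟙 (c u) + χ D u * 𝟙 (not (c u)) ≡⟨ *-distribˡ-+ (χ D u) (𝟙 (c u)) (𝟙 (not (c u))) ⟨
          χ D u * (𝟙 (c u) + 𝟙 (not (c u)))       ≡⟨ cong (χ D u *_) (𝟙+𝟙∘not≡1 (c u)) ⟩
          χ D u * 1                               ≡⟨ *-identityʳ (χ D u) ⟩
          χ D u                                   ∎

      weighted-between≤ : ∀ u v → χ D u * (χ D v * between u v) ≤
                                  4 * (χ D u * (χ D v * δ u v)) + 2 * (red u * blue v + blue u * red v)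
      weighted-between≤ u v = begin
        χ D u * (χ D v * between u v)
          ≤⟨ χ*-mono-≤ D u (λ u∈D → χ*-mono-≤ D v (λ v∈D → between≤ u∈D v∈D)) ⟩
        χ D u * (χ D v * (4 * δ u v + 2 * 𝟙 (c u xor c v)))
          ≡⟨ cong (λ x → χ D u * (χ D v * (4 * δ u v + 2 * x))) (𝟙-xor (c u) (c v)) ⟩
        χ D u * (χ D v * (4 * δ u v + 2 * (𝟙 (c u) * 𝟙 (not (c v)) + 𝟙 (not (c u)) * 𝟙 (c v))))
          ≡⟨ solve 7 (λ χu χv d r b r′ b′ → χu :* (χv :* (con 4 :* d :+ con 2 :* (r :* b′ :+ b :* r′)))
                       := con 4 :* (χu :* (χv :* d)) :+ con 2 :* ((χu :* r) :* (χv :* b′) :+ (χu :* b) :* (χv :* r′)))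
                     refl (χ D u) (χ D v) (δ u v) (𝟙 (c u)) (𝟙 (not (c u))) (𝟙 (c v)) (𝟙 (not (c v))) ⟩
        4 * (χ D u * (χ D v * δ u v)) + 2 * (red u * blue v + blue u * red v)
          ∎
        where open ≤-Reasoning

      edgeCount+edgeCount≤ : edgeCount G + edgeCount G ≤ 4 * ∣ D ∣ + 2 * (sum red * sum blue + sum blue * sum red)
      edgeCount+edgeCount≤ = begin
        edgeCount G + edgeCount G
          ≡⟨ handshake G ⟨
        ∑[ x < n ] ∑[ y < n ] 𝟙 (adj G x y)
          ≡⟨ ∑∑-by-blocks (λ x y → 𝟙 (adj G x y)) ⟩
        ∑[ u < n ] ∑[ v < n ] (χ D u * (χ D v * between u v))
          ≤⟨ ∑-mono-≤ (λ u → ∑-mono-≤ (weighted-between≤ u)) ⟩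
        ∑[ u < n ] ∑[ v < n ] (4 * (χ D u * (χ D v * δ u v)) + 2 * (red u * blue v + blue u * red v))
          ≡⟨ sum-cong-≗ (λ u → ∑-linear 4 2 (λ v → χ D u * (χ D v * δ u v))
                                            (λ v → red u * blue v) (λ v → blue u * red v)) ⟩
        ∑[ u < n ] (4 * ∑[ v < n ] (χ D u * (χ D v * δ u v))
                    + 2 * (∑[ v < n ] (red u * blue v) + ∑[ v < n ] (blue u * red v)))
          ≡⟨ ∑-linear 4 2 (λ u → ∑[ v < n ] (χ D u * (χ D v * δ u v)))
                          (λ u → ∑[ v < n ] (red u * blue v)) (λ u → ∑[ v < n ] (blue u * red v)) ⟩
        4 * ∑[ u < n ] ∑[ v < n ] (χ D u * (χ D v * δ u v))
          + 2 * (∑[ u < n ] ∑[ v < n ] (red u * blue v) + ∑[ u < n ] ∑[ v < n ] (blue u * red v))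
          ≡⟨ cong₂ (λ d x → 4 * d + 2 * x) (∑∑χχδ≡∣p∣ D) (cong₂ _+_ (∑∑-product red blue) (∑∑-product blue red)) ⟩
        4 * ∣ D ∣ + 2 * (sum red * sum blue + sum blue * sum red)
          ∎
        where open ≤-Reasoning

      edgeCount≤ : edgeCount G ≤ 2 * ∣ D ∣ + 2 * ⌈ ∣ D ∣ /2⌉ * ⌊ ∣ D ∣ /2⌋
      edgeCount≤ = begin
        edgeCount G
          ≤⟨ *-cancelˡ-≤ 2 (subst₂ _≤_ doubled doubled′ edgeCount+edgeCount≤) ⟩
        2 * ∣ D ∣ + 2 * (sum red * sum blue)
          ≤⟨ +-monoʳ-≤ (2 * ∣ D ∣) (*-monoʳ-≤ 2 balanced) ⟩
        2 * ∣ D ∣ + 2 * (⌈ ∣ D ∣ /2⌉ * ⌊ ∣ D ∣ /2⌋)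
          ≡⟨ cong (2 * ∣ D ∣ +_) (*-assoc 2 ⌈ ∣ D ∣ /2⌉ ⌊ ∣ D ∣ /2⌋) ⟨
        2 * ∣ D ∣ + 2 * ⌈ ∣ D ∣ /2⌉ * ⌊ ∣ D ∣ /2⌋
          ∎
        where
        open ≤-Reasoning
        doubled : edgeCount G + edgeCount G ≡ 2 * edgeCount G
        doubled = cong (edgeCount G +_) (sym (+-identityʳ (edgeCount G)))
        doubled′ : 4 * ∣ D ∣ + 2 * (sum red * sum blue + sum blue * sum red) ≡
                   2 * (2 * ∣ D ∣ + 2 * (sum red * sum blue))
        doubled′ = solve 3 (λ d k m → con 4 :* d :+ con 2 :* (k :* m :+ m :* k)
                                    := con 2 :* (con 2 :* d :+ con 2 :* (k :* m)))
                         refl ∣ D ∣ (sum red) (sum blue)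
        balanced : sum red * sum blue ≤ ⌈ ∣ D ∣ /2⌉ * ⌊ ∣ D ∣ /2⌋
        balanced = subst (λ s → sum red * sum blue ≤ ⌈ s /2⌉ * ⌊ s /2⌋) ∑red+∑blue≡∣D∣
                         (m*n≤⌈[m+n]/2⌉*⌊[m+n]/2⌋ (sum red) (sum blue))

theorem2p11 : (γ n : ℕ) → (G : Graph n) → 1 ≤ γ → Bipartite G → NoIsolated G → UniqueMinDominating G → DominationNumber G γ → n ≡ 3 * γ → edgeCount G ≤ 2 * γ + 2 * ⌈ γ /2⌉ * ⌊ γ /2⌋
theorem2p11 γ n G _ (c , proper) no-isolated (D , (D-dominating , D-minimum) , D-unique-minimum)
            (D₀ , D₀-minimum , ∣D₀∣≡γ) n≡3γ =
  subst (λ k → edgeCount G ≤ 2 * k + 2 * ⌈ k /2⌉ * ⌊ k /2⌋) ∣D∣≡γ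
        (Blocks.TwoColoured.edgeCount≤ A B pair n≡3∣D∣ c proper)
  where
  ∣D∣≡γ : ∣ D ∣ ≡ γ
  ∣D∣≡γ = trans (cong ∣_∣ (sym (D-unique-minimum D₀ D₀-minimum))) ∣D₀∣≡γ
  n≡3∣D∣ : n ≡ 3 * ∣ D ∣
  n≡3∣D∣ = trans n≡3γ (cong (3 *_) (sym ∣D∣≡γ))
  D-unique : ∀ E → Dominating G E → ∣ E ∣ ≤ ∣ D ∣ → E ≡ D
  D-unique E E-dominating ∣E∣≤∣D∣ =
    D-unique-minimum E (E-dominating , λ F F-dominating → ≤-trans ∣E∣≤∣D∣ (D-minimum F F-dominating))
  open UniqueMinimumDominatingSet G D D-dominating D-unique
  pairs : Σ[ A ∈ (Fin n → Fin n) ] Σ[ B ∈ (Fin n → Fin n) ] (∀ {u} → u ∈ D → PrivatePair u (A u) (B u))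
  pairs = private-pairs no-isolated
  A B : Fin n → Fin n
  A = proj₁ pairs
  B = proj₁ (proj₂ pairs)
  pair : ∀ {u} → u ∈ D → PrivatePair u (A u) (B u)
  pair = proj₂ (proj₂ pairs)
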